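{- Let $a_1,a_2,a_3,a_4,b_1,b_2,b_3,b_4$ be integers such that $\max\{b_1,b_2\}\le\min\{a_1,a_2,a_3,a_4\}$, $\max\{a_1,a_2,a_3,a_4\}<\min\{b_3,b_4\}$, and $a_1+a_2+a_3+a_4\le b_1+b_2+b_3+b_4-2$. Let $a_1^*\le a_2^*\le a_3^*\le a_4^*$ be the numbers $a_1,\dots,a_4$ in non-decreasing order and $b_4^*=\max\{b_3,b_4\}$. For $j=3,4$ let $$R_j(t)=\frac{(b_j-a_j-1)!}{(t+a_j)(t+a_j+1)\cdots(t+b_j-1)}.$$ Then for $j=3,4$: (i) $\bigl(R_j(t)(t+k)\bigr)\big|_{t=-k}\in\mathbb Z$ for every $k\in\mathbb Z$; (ii) $D_{b_4^*-\min\{a_j,a_3^*\}-1}\cdot\frac{d}{dt}\bigl(R_j(t)(t+k)\bigr)\big|_{t=-k}\in\mathbb Z$ for every integer $k$ with $a_3^*\le k\le b_4^*-1$.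
   Context: $D_N$ denotes the least common multiple of $1,2,\dots,N$ (with $D_0=1$). The expression $R_j(t)(t+k)$ is understood as a rational function of $t$ (after cancellation), evaluated at $t=-k$. -}

module Defs where

open import Data.Nat as ℕ using (ℕ; zero; suc)
open import Data.Nat.LCM using (lcm)
open import Data.Nat.Base using (_!)
open import Data.Integer as ℤ using (ℤ; +_; ∣_∣)
open import Data.Integer.Properties as ℤP using (≤-decTotalOrder)
open import Data.Rational as ℚ using (ℚ; 0ℚ; 1ℚ)
open import Data.List using (List; []; _∷_; filter; foldr)
open import Data.Product using (∃; _×_; _,_; proj₁; proj₂)
open import Relation.Nullary using (Dec; yes; no; ¬_)
open import Relation.Nullary.Decidable using (_×-dec_; ¬?)
open import Relation.Binary.PropositionalEquality using (_≡_)
open import Data.List.Sort ≤-decTotalOrder using (sort)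

fromℤ : ℤ → ℚ
fromℤ z = z ℚ./ 1

D : ℕ → ℕ
D zero = 1
D (suc n) = lcm (suc n) (D n)

IsInt : ℚ → Set
IsInt q = ∃ λ (z : ℤ) → q ≡ fromℤ z

nth : ℕ → List ℤ → ℤ
nth _ [] = + 0
nth zero (x ∷ _) = x
nth (suc n) (_ ∷ xs) = nth n xs

a3* : ℤ → ℤ → ℤ → ℤ → ℤ
a3* a1 a2 a3 a4 = nth 2 (sort (a1 ∷ a2 ∷ a3 ∷ a4 ∷ []))

rangeℤ : ℤ → ℕ → List ℤ
rangeℤ a zero = []
rangeℤ a (suc n) = a ∷ rangeℤ (a ℤ.+ + 1) n

-- Dual numbers x + y ε (ε² = 0): value and first derivative
record Dual : Set where
  constructor _⊕ε_
  field
    val : ℚ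
    der : ℚ
open Dual public

_⊗_ : Dual → Dual → Dual
(x ⊕ε y) ⊗ (u ⊕ε v) = (x ℚ.* u) ⊕ε ((x ℚ.* v) ℚ.+ (y ℚ.* u))

-- ∏_{i ∈ is} (t + i) at the dual point t = -k + ε
prodLin : ℤ → List ℤ → Dual
prodLin k = foldr (λ i acc → (fromℤ (i ℤ.- k) ⊕ε 1ℚ) ⊗ acc) (1ℚ ⊕ε 0ℚ)

-- division in ℚ, total (returns 0 on division by 0; never used with 0 below)
_÷?_ : ℚ → ℚ → ℚ
p ÷? q with q ℚ.≟ 0ℚ
... | yes _ = 0ℚ
... | no q≢0 = ℚ._÷_ p q {{ℚ.≢-nonZero q≢0}}

-- Value and derivative at t = -k of a rational function  c · ∏_{i∈num}(t+i) / ∏_{i∈den}(t+i)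
-- (quotient rule on the dual-number values of numerator and denominator)
evalRF : ℚ → List ℤ → List ℤ → ℤ → Dual
evalRF c num den k =
  let N = prodLin k num
      P = prodLin k den
      N0 = c ℚ.* val N
      N1 = c ℚ.* der N
  in (N0 ÷? val P) ⊕ε (((N1 ℚ.* val P) ℚ.- (N0 ℚ.* der P)) ÷? (val P ℚ.* val P))

inRange? : (a b k : ℤ) → Dec ((a ℤ.≤ k) × (k ℤ.< b))
inRange? a b k = (a ℤ.≤? k) ×-dec (k ℤ.<? b)

-- R(t) = (b-a-1)! / ((t+a)(t+a+1)...(t+b-1)),  and the rational function R(t)(t+k)
-- written in lowest terms (the common factor (t+k) cancelled when k ∈ [a, b-1]).
RtimesLin : (a b k : ℤ) → Dual
RtimesLin a b k with inRange? a b k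
... | yes _ = evalRF c [] (filter (λ i → ¬? (i ℤ.≟ k)) poles) k
  where
    c = fromℤ (+ ((∣ b ℤ.- a ∣ ℕ.∸ 1) !))
    poles = rangeℤ a ∣ b ℤ.- a ∣
... | no _ = evalRF c (k ∷ []) poles k
  where
    c = fromℤ (+ ((∣ b ℤ.- a ∣ ℕ.∸ 1) !))
    poles = rangeℤ a ∣ b ℤ.- a ∣

Claims : (a b as3 bs4 : ℤ) → Set
Claims a b as3 bs4 =
  (∀ (k : ℤ) → IsInt (val (RtimesLin a b k)))
  × (∀ (k : ℤ) → as3 ℤ.≤ k → k ℤ.≤ bs4 ℤ.- + 1 →
       IsInt (fromℤ (+ D ∣ bs4 ℤ.- (a ℤ.⊓ as3) ℤ.- + 1 ∣) ℚ.* der (RtimesLin a b k)))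

-- With c = (b-a-1)!, R(t)(t+k) = c·N(t)/P(t),
-- where P is the product of the t+i over the poles i ≠ k, and N = t+k if k is not a pole,
-- N = 1 otherwise. Every offset i-k satisfies 0 < |i-k| ≤ b₄* - min(a, a₃*) - 1, so it
-- divides D.
-- If k is not a pole, the value at -k is 0 and the derivative is c/P(-k), where P(-k) is a
-- product of b-a consecutive integers each dividing D; such a product divides D·(b-a-1)!.
-- If k is a pole, the value is c/P(-k) = ±binom(b-a-1, k-a), and the derivative
-- -(c/P(-k))·Σ 1/(i-k) is made integral by D term by term.
module Submission where

open import Defs
open import Data.Integer using (ℤ; _≤_; _<_; _+_; _-_; _⊓_; _⊔_; +_)
open import Data.Product using (_×_)

open import Function using (_∘_)
open import Data.Nat as ℕ using (ℕ; zero; suc; _∸_; _!)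
import Data.Nat.Properties as ℕP
import Data.Nat.Divisibility as ℕD
open import Data.Nat.LCM using (m∣lcm[m,n]; n∣lcm[m,n])
open import Data.Nat.Combinatorics.Specification using ([n∸k]!k!∣n!)
open import Data.Nat.Coprimality using (1-coprimeTo) renaming (sym to coprime-sym)
open import Data.Integer as ℤ using (_*_; -_; ∣_∣; _≟_; +≤+; +<+)
import Data.Integer.Properties as ℤP
open import Data.Integer.Divisibility.Signed using (_∣_; divides; ∣ᵤ⇒∣)
open import Data.Integer.Solver using (module +-*-Solver)
open +-*-Solver using (solve; _:=_; _:+_; _:*_; _:-_; :-_; con)
open import Data.Rational as ℚ using (ℚ; mkℚ; 0ℚ; 1ℚ)
import Data.Rational.Properties as ℚP
open import Data.List using (List; []; _∷_; _++_; filter)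
import Data.List.Properties as ListP
open import Data.List.Relation.Unary.All as All using (All; []; _∷_)
import Data.List.Relation.Unary.All.Properties as All
open import Data.Product using (_,_; ∃₂)
open import Data.Sum using (inj₁; inj₂)
open import Relation.Nullary using (yes; no; contradiction)
open import Relation.Nullary.Decidable using (¬?)
open import Relation.Binary.PropositionalEquality
  using (_≡_; _≢_; refl; sym; trans; cong; cong₂; subst; subst₂; module ≡-Reasoning)
open ≡-Reasoning

fromℤ≡mkℚ : ∀ z → fromℤ z ≡ mkℚ z 0 (coprime-sym (1-coprimeTo ∣ z ∣))
fromℤ≡mkℚ z = ℚP.↥p/↧p≡p (mkℚ z 0 _)

fromℤ-homo-* : ∀ x y → fromℤ (x * y) ≡ fromℤ x ℚ.* fromℤ y
fromℤ-homo-* x y = sym (cong₂ ℚ._*_ (fromℤ≡mkℚ x) (fromℤ≡mkℚ y))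

fromℤ-homo-+ : ∀ x y → fromℤ (x + y) ≡ fromℤ x ℚ.+ fromℤ y
fromℤ-homo-+ x y = begin
  fromℤ (x + y)                  ≡⟨ cong fromℤ (cong₂ _+_ (sym (ℤP.*-identityʳ x)) (sym (ℤP.*-identityʳ y))) ⟩
  fromℤ (x * + 1 + y * + 1)      ≡⟨ sym (cong₂ ℚ._+_ (fromℤ≡mkℚ x) (fromℤ≡mkℚ y)) ⟩
  fromℤ x ℚ.+ fromℤ y            ∎

fromℤ-homo‿- : ∀ x → fromℤ (- x) ≡ ℚ.- fromℤ x
fromℤ-homo‿- x = trans (fromℤ≡mkℚ (- x)) (trans (neg-mkℚ x) (cong ℚ.-_ (sym (fromℤ≡mkℚ x))))
  where
  neg-mkℚ : ∀ x → mkℚ (- x) 0 (coprime-sym (1-coprimeTo ∣ - x ∣))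
                  ≡ ℚ.- mkℚ x 0 (coprime-sym (1-coprimeTo ∣ x ∣))
  neg-mkℚ (+ zero)    = refl
  neg-mkℚ (+ suc n)   = refl
  neg-mkℚ ℤ.-[1+ n ] = refl

fromℤ-homo-− : ∀ x y → fromℤ (x - y) ≡ fromℤ x ℚ.- fromℤ y
fromℤ-homo-− x y = trans (fromℤ-homo-+ x (- y)) (cong (λ q → fromℤ x ℚ.+ q) (fromℤ-homo‿- y))

IsInt-*÷? : ∀ d x y → y ∣ d * x → IsInt (fromℤ d ℚ.* (fromℤ x ÷? fromℤ y))
IsInt-*÷? d x y (divides z d*x≡z*y) with fromℤ y ℚ.≟ 0ℚ
... | yes _   = + 0 , ℚP.*-zeroʳ (fromℤ d)
... | no y≢0 = z , (begin
  fromℤ d ℚ.* (fromℤ x ℚ.* ℚ.1/ q)   ≡⟨ sym (ℚP.*-assoc (fromℤ d) (fromℤ x) (ℚ.1/ q)) ⟩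
  (fromℤ d ℚ.* fromℤ x) ℚ.* ℚ.1/ q   ≡⟨ cong (ℚ._* ℚ.1/ q) (sym (fromℤ-homo-* d x)) ⟩
  fromℤ (d * x) ℚ.* ℚ.1/ q           ≡⟨ cong (λ u → fromℤ u ℚ.* ℚ.1/ q) d*x≡z*y ⟩
  fromℤ (z * y) ℚ.* ℚ.1/ q           ≡⟨ cong (ℚ._* ℚ.1/ q) (fromℤ-homo-* z y) ⟩
  (fromℤ z ℚ.* q) ℚ.* ℚ.1/ q         ≡⟨ ℚP.*-assoc (fromℤ z) q (ℚ.1/ q) ⟩
  fromℤ z ℚ.* (q ℚ.* ℚ.1/ q)         ≡⟨ cong (fromℤ z ℚ.*_) (ℚP.*-inverseʳ q) ⟩
  fromℤ z ℚ.* 1ℚ                     ≡⟨ ℚP.*-identityʳ (fromℤ z) ⟩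
  fromℤ z                            ∎)
  where
  q = fromℤ y
  instance _ = ℚ.≢-nonZero y≢0

IsInt-÷? : ∀ x y → y ∣ x → IsInt (fromℤ x ÷? fromℤ y)
IsInt-÷? x y y∣x with IsInt-*÷? (+ 1) x y (subst (y ∣_) (sym (ℤP.*-identityˡ x)) y∣x)
... | z , eq = z , trans (sym (ℚP.*-identityˡ _)) eq

prodVal : ℤ → List ℤ → ℤ
prodVal k []       = + 1
prodVal k (i ∷ is) = (i - k) * prodVal k is

prodDer : ℤ → List ℤ → ℤ
prodDer k []       = + 0
prodDer k (i ∷ is) = (i - k) * prodDer k is + prodVal k is

prodLin≡fromℤ : ∀ k is → prodLin k is ≡ fromℤ (prodVal k is) ⊕ε fromℤ (prodDer k is)
prodLin≡fromℤ k []       = refl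
prodLin≡fromℤ k (i ∷ is) rewrite prodLin≡fromℤ k is = cong₂ _⊕ε_
  (sym (fromℤ-homo-* (i - k) (prodVal k is)))
  (sym (trans (fromℤ-homo-+ ((i - k) * prodDer k is) (prodVal k is))
              (cong₂ ℚ._+_ (fromℤ-homo-* (i - k) (prodDer k is))
                           (sym (ℚP.*-identityˡ (fromℤ (prodVal k is)))))))

prodVal-self : ∀ k → prodVal k (k ∷ []) ≡ + 0
prodVal-self k rewrite ℤP.+-inverseʳ k = refl

prodDer-self : ∀ k → prodDer k (k ∷ []) ≡ + 1
prodDer-self k rewrite ℤP.+-inverseʳ k = refl

evalRF-val≡ : ∀ C num den k →
  val (evalRF (fromℤ C) num den k) ≡ fromℤ (C * prodVal k num) ÷? fromℤ (prodVal k den)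
evalRF-val≡ C num den k
  rewrite prodLin≡fromℤ k num | prodLin≡fromℤ k den | fromℤ-homo-* C (prodVal k num) = refl

evalRF-der≡ : ∀ C num den k →
  der (evalRF (fromℤ C) num den k)
    ≡ fromℤ ((C * prodDer k num) * prodVal k den - (C * prodVal k num) * prodDer k den)
      ÷? fromℤ (prodVal k den * prodVal k den)
evalRF-der≡ C num den k
  rewrite prodLin≡fromℤ k num | prodLin≡fromℤ k den
        | fromℤ-homo-− ((C * prodDer k num) * prodVal k den) ((C * prodVal k num) * prodDer k den)
        | fromℤ-homo-* (C * prodDer k num) (prodVal k den)
        | fromℤ-homo-* (C * prodVal k num) (prodDer k den)
        | fromℤ-homo-* C (prodDer k num) | fromℤ-homo-* C (prodVal k num)
        | fromℤ-homo-* (prodVal k den) (prodVal k den) = refl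

IsInt-val-const : ∀ C den k → prodVal k den ∣ C → IsInt (val (evalRF (fromℤ C) [] den k))
IsInt-val-const C den k P∣C rewrite evalRF-val≡ C [] den k | ℤP.*-identityʳ C =
  IsInt-÷? C (prodVal k den) P∣C

IsInt-val-linear : ∀ C den k → IsInt (val (evalRF (fromℤ C) (k ∷ []) den k))
IsInt-val-linear C den k rewrite evalRF-val≡ C (k ∷ []) den k | prodVal-self k | ℤP.*-zeroʳ C =
  IsInt-÷? (+ 0) (prodVal k den) (divides (+ 0) refl)

IsInt-der-const : ∀ d C den k → prodVal k den ∣ C → prodVal k den ∣ d * prodDer k den →
  IsInt (fromℤ d ℚ.* der (evalRF (fromℤ C) [] den k))
IsInt-der-const d C den k (divides u C≡uP) (divides w dP′≡wP) rewrite evalRF-der≡ C [] den k =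
  IsInt-*÷? d _ (P * P) (divides (- (u * w)) (begin
    d * ((C * + 0) * P - (C * + 1) * P′)
      ≡⟨ solve 4 (λ d C P P′ → d :* ((C :* con (+ 0)) :* P :- (C :* con (+ 1)) :* P′)
                               := :- (C :* (d :* P′))) refl d C P P′ ⟩
    - (C * (d * P′))                ≡⟨ cong₂ (λ x y → - (x * y)) C≡uP dP′≡wP ⟩
    - ((u * P) * (w * P))
      ≡⟨ solve 3 (λ u w P → :- ((u :* P) :* (w :* P)) := (:- (u :* w)) :* (P :* P)) refl u w P ⟩
    - (u * w) * (P * P)             ∎))
  where
  P = prodVal k den
  P′ = prodDer k den

IsInt-der-linear : ∀ d C den k → prodVal k den ∣ d * C →
  IsInt (fromℤ d ℚ.* der (evalRF (fromℤ C) (k ∷ []) den k))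
IsInt-der-linear d C den k (divides g dC≡gP)
  rewrite evalRF-der≡ C (k ∷ []) den k | prodVal-self k | prodDer-self k =
  IsInt-*÷? d _ (P * P) (divides g (begin
    d * ((C * + 1) * P - (C * + 0) * P′)
      ≡⟨ solve 4 (λ d C P P′ → d :* ((C :* con (+ 1)) :* P :- (C :* con (+ 0)) :* P′)
                               := (d :* C) :* P) refl d C P P′ ⟩
    (d * C) * P                     ≡⟨ cong (_* P) dC≡gP ⟩
    (g * P) * P                     ≡⟨ ℤP.*-assoc g P P ⟩
    g * (P * P)                     ∎))
  where
  P = prodVal k den
  P′ = prodDer k den

prodVal∣*prodDer : ∀ {k d} is → All (λ i → (i - k) ∣ d) is → prodVal k is ∣ d * prodDer k is
prodVal∣*prodDer {d = d} [] [] = divides (+ 0) (ℤP.*-zeroʳ d)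
prodVal∣*prodDer {k} {d} (i ∷ is) (divides q d≡qx ∷ rest) with prodVal∣*prodDer is rest
... | divides w dP′≡wP = divides (w + q) (begin
  d * (x * P′ + P)                  ≡⟨ solve 4 (λ d x P′ P → d :* (x :* P′ :+ P)
                                                          := x :* (d :* P′) :+ d :* P) refl d x P′ P ⟩
  x * (d * P′) + d * P              ≡⟨ cong₂ (λ u v → x * u + v * P) dP′≡wP d≡qx ⟩
  x * (w * P) + (q * x) * P         ≡⟨ solve 4 (λ x w P q → x :* (w :* P) :+ (q :* x) :* P
                                                          := (w :+ q) :* (x :* P)) refl x w P q ⟩
  (w + q) * (x * P)                 ∎)
  where
  x = i - k
  P = prodVal k is
  P′ = prodDer k is

rangeℤ-++ : ∀ a m n → rangeℤ a (m ℕ.+ n) ≡ rangeℤ a m ++ rangeℤ (a + + m) n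
rangeℤ-++ a zero    n rewrite ℤP.+-identityʳ a = refl
rangeℤ-++ a (suc m) n rewrite rangeℤ-++ (a + + 1) m n | ℤP.+-assoc a (+ 1) (+ m) = refl

rangeℤ-snoc : ∀ a n → rangeℤ a (suc n) ≡ rangeℤ a n ++ (a + + n) ∷ []
rangeℤ-snoc a n = trans (cong (rangeℤ a) (ℕP.+-comm 1 n)) (rangeℤ-++ a n 1)

prodVal-++ : ∀ k xs ys → prodVal k (xs ++ ys) ≡ prodVal k xs * prodVal k ys
prodVal-++ k []       ys = sym (ℤP.*-identityˡ _)
prodVal-++ k (x ∷ xs) ys rewrite prodVal-++ k xs ys = sym (ℤP.*-assoc (x - k) (prodVal k xs) _)

prodVal-rangeℤ-snoc : ∀ k a n → prodVal k (rangeℤ a (suc n)) ≡ prodVal k (rangeℤ a n) * ((a + + n) - k)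
prodVal-rangeℤ-snoc k a n = begin
  prodVal k (rangeℤ a (suc n))                        ≡⟨ cong (prodVal k) (rangeℤ-snoc a n) ⟩
  prodVal k (rangeℤ a n ++ (a + + n) ∷ [])            ≡⟨ prodVal-++ k (rangeℤ a n) _ ⟩
  prodVal k (rangeℤ a n) * ((a + + n - k) * + 1)      ≡⟨ cong (prodVal k (rangeℤ a n) *_) (ℤP.*-identityʳ _) ⟩
  prodVal k (rangeℤ a n) * ((a + + n) - k)            ∎

i<i+suc[n] : ∀ i n → i < i + + suc n
i<i+suc[n] i n = ℤP.≤-<-trans (ℤP.i≤i+j i (+ n)) (ℤP.+-monoʳ-< i (+<+ (ℕP.n<1+n n)))

rangeℤ-bounded : ∀ a n → All (λ i → a ≤ i × i < a + + n) (rangeℤ a n)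
rangeℤ-bounded a zero    = []
rangeℤ-bounded a (suc n) = (ℤP.≤-refl , i<i+suc[n] a n) ∷ All.map shift (rangeℤ-bounded (a + + 1) n)
  where
  shift : ∀ {i} → a + + 1 ≤ i × i < a + + 1 + + n → a ≤ i × i < a + + suc n
  shift (a+1≤i , i<a+1+n) =
    ℤP.≤-trans (ℤP.i≤i+j a (+ 1)) a+1≤i , subst (_ <_) (ℤP.+-assoc a (+ 1) (+ n)) i<a+1+n

remove : ℤ → List ℤ → List ℤ
remove k = filter (λ i → ¬? (i ≟ k))

remove-rangeℤ : ∀ a m r → remove (a + + m) (rangeℤ a (suc (m ℕ.+ r))) ≡ rangeℤ a m ++ rangeℤ (a + + m + + 1) r
remove-rangeℤ a m r = begin
  filter ≢k? (rangeℤ a (suc (m ℕ.+ r)))         ≡⟨ cong (filter ≢k? ∘ rangeℤ a) (sym (ℕP.+-suc m r)) ⟩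
  filter ≢k? (rangeℤ a (m ℕ.+ suc r))           ≡⟨ cong (filter ≢k?) (rangeℤ-++ a m (suc r)) ⟩
  filter ≢k? (rangeℤ a m ++ k ∷ above)          ≡⟨ ListP.filter-++ ≢k? (rangeℤ a m) _ ⟩
  filter ≢k? (rangeℤ a m) ++ filter ≢k? (k ∷ above)
    ≡⟨ cong₂ _++_ (ListP.filter-all ≢k? (All.map below≢k (rangeℤ-bounded a m)))
                  (trans (ListP.filter-reject ≢k? (λ k≢k → k≢k refl))
                         (ListP.filter-all ≢k? (All.map above≢k (rangeℤ-bounded (k + + 1) r)))) ⟩
  rangeℤ a m ++ above                           ∎
  where
  k = a + + m
  above = rangeℤ (k + + 1) r
  ≢k? = λ i → ¬? (i ≟ k)
  below≢k : ∀ {i} → a ≤ i × i < k → i ≢ k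
  below≢k (_ , i<k) = ℤP.<⇒≢ i<k
  above≢k : ∀ {i} → k + + 1 ≤ i × i < k + + 1 + + r → i ≢ k
  above≢k (k+1≤i , _) i≡k = ℤP.<⇒≢ (ℤP.<-≤-trans (i<i+suc[n] k 0) k+1≤i) (sym i≡k)

abs-prodVal-below : ∀ k a m → a + + m ≡ k → ∣ prodVal k (rangeℤ a m) ∣ ≡ m !
abs-prodVal-below k a zero    _       = refl
abs-prodVal-below k a (suc m) a+m≡k = begin
  ∣ (a - k) * prodVal k (rangeℤ (a + + 1) m) ∣         ≡⟨ ℤP.abs-* (a - k) _ ⟩
  ∣ a - k ∣ ℕ.* ∣ prodVal k (rangeℤ (a + + 1) m) ∣     ≡⟨ cong₂ ℕ._*_ ∣a-k∣≡1+m
                                                         (abs-prodVal-below k (a + + 1) m a+1+m≡k) ⟩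
  suc m ℕ.* m !                                        ∎
  where
  ∣a-k∣≡1+m : ∣ a - k ∣ ≡ suc m
  ∣a-k∣≡1+m = cong ∣_∣ (trans (cong (λ x → a - x) (sym a+m≡k))
                              (solve 2 (λ a n → a :- (a :+ n) := :- n) refl a (+ suc m)))
  a+1+m≡k = trans (ℤP.+-assoc a (+ 1) (+ m)) a+m≡k

abs-prodVal-above : ∀ k j r → j ! ℕ.* ∣ prodVal k (rangeℤ (k + + suc j) r) ∣ ≡ (j ℕ.+ r) !
abs-prodVal-above k j zero    rewrite ℕP.+-identityʳ j = ℕP.*-identityʳ (j !)
abs-prodVal-above k j (suc r) = begin
  j ! ℕ.* ∣ (k + + suc j - k) * prodVal k (rangeℤ (k + + suc j + + 1) r) ∣
    ≡⟨ cong (j ! ℕ.*_) (ℤP.abs-* (k + + suc j - k) _) ⟩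
  j ! ℕ.* (∣ k + + suc j - k ∣ ℕ.* ∣ prodVal k (rangeℤ (k + + suc j + + 1) r) ∣)
    ≡⟨ cong₂ (λ x y → j ! ℕ.* (x ℕ.* ∣ prodVal k (rangeℤ y r) ∣)) ∣k+1+j-k∣≡1+j k+1+j+1≡k+2+j ⟩
  j ! ℕ.* (suc j ℕ.* rest)
    ≡⟨ trans (sym (ℕP.*-assoc (j !) (suc j) rest)) (cong (ℕ._* rest) (ℕP.*-comm (j !) (suc j))) ⟩
  suc j ! ℕ.* rest                                     ≡⟨ abs-prodVal-above k (suc j) r ⟩
  (suc j ℕ.+ r) !                                      ≡⟨ cong _! (sym (ℕP.+-suc j r)) ⟩
  (j ℕ.+ suc r) !                                      ∎
  where
  rest = ∣ prodVal k (rangeℤ (k + + suc (suc j)) r) ∣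
  ∣k+1+j-k∣≡1+j : ∣ k + + suc j - k ∣ ≡ suc j
  ∣k+1+j-k∣≡1+j = cong ∣_∣ (solve 2 (λ k n → (k :+ n) :- k := n) refl k (+ suc j))
  k+1+j+1≡k+2+j : k + + suc j + + 1 ≡ k + + suc (suc j)
  k+1+j+1≡k+2+j = trans (ℤP.+-assoc k (+ suc j) (+ 1)) (cong (λ n → k + + n) (ℕP.+-comm (suc j) 1))

-- Up to sign, the product is m!·r!, and (m+r)!/(m!·r!) is a binomial coefficient.
prodVal-remove-rangeℤ∣! : ∀ a m r → prodVal (a + + m) (remove (a + + m) (rangeℤ a (suc (m ℕ.+ r)))) ∣ + ((m ℕ.+ r) !)
prodVal-remove-rangeℤ∣! a m r = ∣ᵤ⇒∣ (subst (ℕD._∣ (m ℕ.+ r) !) (sym ∣P∣≡m!r!) m!r!∣[m+r]!)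
  where
  k = a + + m
  below = rangeℤ a m
  above = rangeℤ (k + + 1) r
  ∣P∣≡m!r! : ∣ prodVal k (remove k (rangeℤ a (suc (m ℕ.+ r)))) ∣ ≡ m ! ℕ.* r !
  ∣P∣≡m!r! = begin
    ∣ prodVal k (remove k (rangeℤ a (suc (m ℕ.+ r)))) ∣ ≡⟨ cong (∣_∣ ∘ prodVal k) (remove-rangeℤ a m r) ⟩
    ∣ prodVal k (below ++ above) ∣                     ≡⟨ cong ∣_∣ (prodVal-++ k below above) ⟩
    ∣ prodVal k below * prodVal k above ∣              ≡⟨ ℤP.abs-* (prodVal k below) _ ⟩
    ∣ prodVal k below ∣ ℕ.* ∣ prodVal k above ∣
      ≡⟨ cong₂ ℕ._*_ (abs-prodVal-below k a m refl)
                     (trans (sym (ℕP.*-identityˡ _)) (abs-prodVal-above k 0 r)) ⟩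
    m ! ℕ.* r !                                        ∎
  m!r!∣[m+r]! : m ! ℕ.* r ! ℕD.∣ (m ℕ.+ r) !
  m!r!∣[m+r]! = subst (λ x → x ! ℕ.* r ! ℕD.∣ (m ℕ.+ r) !) (ℕP.m+n∸n≡m m r)
                      ([n∸k]!k!∣n! (ℕP.m≤n+m r m))

-- Induction on the length via n/(x⋯(x+n)) = 1/(x⋯(x+n-1)) - 1/((x+1)⋯(x+n)).
prodVal-rangeℤ∣*! : ∀ {k d} s n → All (λ i → (i - k) ∣ d) (rangeℤ s n) →
  prodVal k (rangeℤ s n) ∣ d * + ((n ∸ 1) !)
prodVal-rangeℤ∣*! s zero    _ = ∣ᵤ⇒∣ (ℕD.1∣ _)
prodVal-rangeℤ∣*! {k} {d} s (suc zero) (divides q d≡qx ∷ []) =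
  divides q (trans (ℤP.*-identityʳ d) (trans d≡qx (cong (q *_) (sym (ℤP.*-identityʳ (s - k))))))
prodVal-rangeℤ∣*! {k} {d} s (suc (suc n)) all
  with prodVal-rangeℤ∣*! s (suc n) (All.++⁻ˡ (rangeℤ s (suc n)) (subst (All _) (rangeℤ-snoc s (suc n)) all))
     | prodVal-rangeℤ∣*! (s + + 1) (suc n) (All.tail all)
... | divides u X≡uP₀ | divides v X≡vP₁ = divides (u - v) (begin
  d * + (suc n !)                  ≡⟨ cong (d *_) (ℤP.pos-* (suc n) (n !)) ⟩
  d * (+ suc n * + (n !))
    ≡⟨ solve 5 (λ d N F s k → d :* (N :* F) := (d :* F) :* ((s :+ N) :- k) :- (d :* F) :* (s :- k))
             refl d (+ suc n) (+ (n !)) s k ⟩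
  X * T - X * σ                    ≡⟨ cong₂ (λ x y → x * T - y * σ) X≡uP₀ X≡vP₁ ⟩
  (u * P₀) * T - (v * P₁) * σ
    ≡⟨ solve 6 (λ u v P₀ P₁ T σ → (u :* P₀) :* T :- (v :* P₁) :* σ := u :* (P₀ :* T) :- v :* (σ :* P₁))
             refl u v P₀ P₁ T σ ⟩
  u * (P₀ * T) - v * P             ≡⟨ cong (λ x → u * x - v * P) (sym (prodVal-rangeℤ-snoc k s (suc n))) ⟩
  u * P - v * P                    ≡⟨ solve 3 (λ u v P → u :* P :- v :* P := (u :- v) :* P) refl u v P ⟩
  (u - v) * P                      ∎)
  where
  X = d * + (n !)
  σ = s - k
  T = s + + suc n - k
  P₀ = prodVal k (rangeℤ s (suc n))
  P₁ = prodVal k (rangeℤ (s + + 1) (suc n))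
  P = σ * P₁

m∣D : ∀ {m} N → 0 ℕ.< m → m ℕ.≤ N → m ℕD.∣ D N
m∣D zero    0<m m≤0 with () ← ℕP.<-≤-trans 0<m m≤0
m∣D (suc N) 0<m m≤1+N with ℕP.m≤n⇒m<n∨m≡n m≤1+N
... | inj₂ refl       = m∣lcm[m,n] (suc N) (D N)
... | inj₁ (ℕ.s≤s m≤N) = ℕD.∣-trans (m∣D N 0<m m≤N) (n∣lcm[m,n] (suc N) (D N))

i∣D : ∀ {i} N → i ≢ + 0 → ∣ i ∣ ℕ.≤ N → i ∣ + D N
i∣D N i≢0 ∣i∣≤N = ∣ᵤ⇒∣ (m∣D N (ℕP.n≢0⇒n>0 (i≢0 ∘ ℤP.∣i∣≡0⇒i≡0)) ∣i∣≤N)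

∣i-j∣≤∣B-e-1∣ : ∀ {e i j B} → e ≤ i → i < B → e ≤ j → j < B → ∣ i - j ∣ ℕ.≤ ∣ B - e - + 1 ∣
∣i-j∣≤∣B-e-1∣ {e} {i} {j} {B} e≤i i<B e≤j j<B =
  ℤP.drop‿+≤+ (subst (_ ≤_) (sym (ℤP.0≤i⇒+∣i∣≡i (ℤP.≤-trans (+≤+ ℕ.z≤n) ∣i-j∣≤))) ∣i-j∣≤)
  where
  ordered : ∀ {x y} → x ≤ y → e ≤ x → y < B → + ∣ x - y ∣ ≤ B - e - + 1
  ordered {x} {y} x≤y e≤x y<B =
    subst₂ _≤_ (sym (ℤP.∣-∣-≤ x≤y))
               (solve 2 (λ B e → (con ℤ.-1ℤ :+ B) :- e := B :- e :- con (+ 1)) refl B e)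
               (ℤP.+-mono-≤ (ℤP.i<j⇒i≤pred[j] y<B) (ℤP.neg-mono-≤ e≤x))
  ∣i-j∣≤ : + ∣ i - j ∣ ≤ B - e - + 1
  ∣i-j∣≤ with ℤP.≤-total i j
  ... | inj₁ i≤j = ordered i≤j e≤i j<B
  ... | inj₂ j≤i = subst (λ n → + n ≤ _) (ℤP.∣i-j∣≡∣j-i∣ j i) (ordered j≤i e≤j i<B)

pole-offset∣D : ∀ {e i k B} → e ≤ i → i < B → e ≤ k → k < B → i ≢ k → (i - k) ∣ + D (∣ B - e - + 1 ∣)
pole-offset∣D {i = i} {k} e≤i i<B e≤k k<B i≢k =
  i∣D _ (i≢k ∘ ℤP.i-j≡0⇒i≡j i k) (∣i-j∣≤∣B-e-1∣ e≤i i<B e≤k k<B)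

i+∣j-i∣≡j : ∀ {i j} → i ≤ j → i + + ∣ j - i ∣ ≡ j
i+∣j-i∣≡j {i} {j} i≤j = trans (cong (λ x → i + x) (ℤP.0≤i⇒+∣i∣≡i (ℤP.i≤j⇒0≤j-i i≤j)))
                              (solve 2 (λ i j → i :+ (j :- i) := j) refl i j)

-- The constant and the pole list of R, as bound in the where-blocks of RtimesLin.
R-coefficient : ℤ → ℤ → ℤ
R-coefficient a b = + ((∣ b - a ∣ ∸ 1) !)

poles : ℤ → ℤ → List ℤ
poles a b = rangeℤ a ∣ b - a ∣

poles-bounded : ∀ {a b} → a ≤ b → All (λ i → a ≤ i × i < b) (poles a b)
poles-bounded {a} {b} a≤b =
  subst (λ x → All (λ i → a ≤ i × i < x) (poles a b)) (i+∣j-i∣≡j a≤b) (rangeℤ-bounded a ∣ b - a ∣)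

pole-split : ∀ {a b k} → a ≤ k → k < b → ∃₂ λ m r → k ≡ a + + m × ∣ b - a ∣ ≡ suc (m ℕ.+ r)
pole-split {a} {b} {k} a≤k k<b = m , L ∸ suc m , sym (i+∣j-i∣≡j a≤k) , sym (ℕP.m+[n∸m]≡n m<L)
  where
  m = ∣ k - a ∣
  L = ∣ b - a ∣
  a≤b = ℤP.<⇒≤ (ℤP.≤-<-trans a≤k k<b)
  m<L : m ℕ.< L
  m<L with m ℕ.<? L
  ... | yes m<L = m<L
  ... | no m≮L = contradiction (subst₂ _≤_ (i+∣j-i∣≡j a≤b) (i+∣j-i∣≡j a≤k)
                                          (ℤP.+-monoʳ-≤ a (+≤+ (ℕP.≮⇒≥ m≮L)))) (ℤP.<⇒≱ k<b)

prodVal-remove-pole∣ : ∀ {a b k} → a ≤ k → k < b → prodVal k (remove k (poles a b)) ∣ R-coefficient a b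
prodVal-remove-pole∣ {a} a≤k k<b with pole-split a≤k k<b
... | m , r , refl , L≡1+m+r rewrite L≡1+m+r = prodVal-remove-rangeℤ∣! a m r

RtimesLin-val-IsInt : ∀ a b k → IsInt (val (RtimesLin a b k))
RtimesLin-val-IsInt a b k with inRange? a b k
... | yes (a≤k , k<b) = IsInt-val-const (R-coefficient a b) (remove k (poles a b)) k (prodVal-remove-pole∣ a≤k k<b)
... | no _            = IsInt-val-linear (R-coefficient a b) (poles a b) k

RtimesLin-der-IsInt : ∀ {a b k} d → a ≤ b → (∀ {i} → a ≤ i → i < b → i ≢ k → (i - k) ∣ d) →
  IsInt (fromℤ d ℚ.* der (RtimesLin a b k))
RtimesLin-der-IsInt {a} {b} {k} d a≤b pole∣d with inRange? a b k
... | yes (a≤k , k<b) = IsInt-der-const d (R-coefficient a b) (remove k (poles a b)) k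
                          (prodVal-remove-pole∣ a≤k k<b) (prodVal∣*prodDer _ others∣d)
  where
  ≢k? = λ i → ¬? (i ≟ k)
  others∣d : All (λ i → (i - k) ∣ d) (remove k (poles a b))
  others∣d = All.zipWith (λ (i≢k , a≤i , i<b) → pole∣d a≤i i<b i≢k)
                (All.all-filter ≢k? (poles a b) , All.filter⁺ ≢k? (poles-bounded a≤b))
... | no k∉[a,b[ = IsInt-der-linear d (R-coefficient a b) (poles a b) k
                     (prodVal-rangeℤ∣*! a ∣ b - a ∣ (All.map pole∣ (poles-bounded a≤b)))
  where
  pole∣ : ∀ {i} → a ≤ i × i < b → (i - k) ∣ d
  pole∣ (a≤i , i<b) = pole∣d a≤i i<b (λ { refl → k∉[a,b[ (a≤i , i<b) })

claims : ∀ {a b as3 bs4} → a ≤ b → b ≤ bs4 → Claims a b as3 bs4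
claims {a} {b} {as3} {bs4} a≤b b≤bs4 =
  RtimesLin-val-IsInt a b ,
  λ k as3≤k k≤bs4-1 → RtimesLin-der-IsInt _ a≤b λ a≤i i<b →
    pole-offset∣D (ℤP.≤-trans (ℤP.i⊓j≤i a as3) a≤i) (ℤP.<-≤-trans i<b b≤bs4)
                  (ℤP.≤-trans (ℤP.i⊓j≤j a as3) as3≤k)
                  (ℤP.i≤pred[j]⇒i<j (subst (k ≤_) (ℤP.+-comm bs4 (- + 1)) k≤bs4-1))

lemma3 : (a1 a2 a3 a4 b1 b2 b3 b4 : ℤ)
    → b1 ⊔ b2 ≤ a1 ⊓ a2 ⊓ a3 ⊓ a4
    → a1 ⊔ a2 ⊔ a3 ⊔ a4 < b3 ⊓ b4
    → a1 + a2 + a3 + a4 ≤ b1 + b2 + b3 + b4 - + 2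
    → Claims a3 b3 (a3* a1 a2 a3 a4) (b3 ⊔ b4) × Claims a4 b4 (a3* a1 a2 a3 a4) (b3 ⊔ b4)
lemma3 a1 a2 a3 a4 b1 b2 b3 b4 _ max<min _ =
    claims (ℤP.<⇒≤ (below-min a3≤max (ℤP.i⊓j≤i b3 b4))) (ℤP.i≤i⊔j b3 b4)
  , claims (ℤP.<⇒≤ (below-min a4≤max (ℤP.i⊓j≤j b3 b4))) (ℤP.i≤j⊔i b3 b4)
  where
  below-min : ∀ {a b} → a ≤ a1 ⊔ a2 ⊔ a3 ⊔ a4 → b3 ⊓ b4 ≤ b → a < b
  below-min a≤max min≤b = ℤP.≤-<-trans a≤max (ℤP.<-≤-trans max<min min≤b)
  a3≤max : a3 ≤ a1 ⊔ a2 ⊔ a3 ⊔ a4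
  a3≤max = ℤP.≤-trans (ℤP.i≤j⊔i (a1 ⊔ a2) a3) (ℤP.i≤i⊔j (a1 ⊔ a2 ⊔ a3) a4)
  a4≤max : a4 ≤ a1 ⊔ a2 ⊔ a3 ⊔ a4
  a4≤max = ℤP.i≤j⊔i (a1 ⊔ a2 ⊔ a3) a4
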